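{- Let $0\le h\le k\le n$ be integers. Assume $S\subseteq[1,n]^2$ is a no-$(k+1)$-in-line set of size $kn$ having reserve $h$. Then for all integers $k',h'$ with $0\le h'\le k'$ and $k-k'=h-h'\ge0$, there is a no-$(k'+1)$-in-line set $S'\subseteq[1,n]^2$ of size $k'n$ having reserve $h'$.
   Context: $[a,b]=\{x\in\mathbb{Z}:a\le x\le b\}$. A set $S\subseteq\mathcal{G}=[1,n]^2$ is a no-$(k+1)$-in-line set if $|S\cap\ell|\le k$ for every Euclidean line $\ell$; it has reserve $h$ if moreover $|S\cap\ell|\le k-h$ for every line $\ell$ that is neither horizontal nor vertical and meets $\mathcal{G}$ in at least two points. -}

module Defs where

open import Data.Nat as ℕ using (ℕ)
open import Data.Integer as ℤ using (ℤ; +_; _*_; _+_)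
open import Data.Product using (_×_; _,_; Σ; ∃-syntax)
open import Data.List using (List; filter; length)
open import Data.List.Membership.Propositional using (_∈_)
open import Data.List.Relation.Unary.All using (All)
open import Data.List.Relation.Unary.Unique.Propositional using (Unique)
open import Relation.Binary.PropositionalEquality using (_≡_; _≢_)
open import Relation.Nullary using (¬_; Dec)
open import Relation.Unary using (Decidable)

Point : Set
Point = ℤ × ℤ

InGrid : ℕ → Point → Set
InGrid n (x , y) = (+ 1 ℤ.≤ x × x ℤ.≤ + n) × (+ 1 ℤ.≤ y × y ℤ.≤ + n)

-- A line a·x + b·y = c with integer coefficients, (a,b) ≠ (0,0).
-- Restricting to integer-coefficient lines is harmless.
record Line : Set where
  constructor line
  field
    a b c : ℤ
    nondeg : ¬ (a ≡ + 0 × b ≡ + 0)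
open Line public

OnLine : Line → Point → Set
OnLine ℓ (x , y) = a ℓ * x + b ℓ * y ≡ c ℓ

onLine? : (ℓ : Line) → Decidable (OnLine ℓ)
onLine? ℓ (x , y) = a ℓ * x + b ℓ * y ℤ.≟ c ℓ

count : Line → List Point → ℕ
count ℓ S = length (filter (onLine? ℓ) S)

Slanted : Line → Set
Slanted ℓ = ¬ (a ℓ ≡ + 0) × ¬ (b ℓ ≡ + 0)

MeetsGridTwice : ℕ → Line → Set
MeetsGridTwice n ℓ =
  ∃[ p ] ∃[ q ] (p ≢ q × InGrid n p × InGrid n q × OnLine ℓ p × OnLine ℓ q)

GridSet : ℕ → List Point → Set
GridSet n S = All (InGrid n) S × Unique S

NoInLine : ℕ → ℕ → List Point → Set
NoInLine n k S = GridSet n S × (∀ ℓ → count ℓ S ℕ.≤ k)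

-- reserve h: |S ∩ ℓ| ≤ k - h (i.e. |S ∩ ℓ| + h ≤ k) for slanted ℓ meeting G twice.
HasReserve : ℕ → ℕ → ℕ → List Point → Set
HasReserve n k h S =
  ∀ ℓ → Slanted ℓ → MeetsGridTwice n ℓ → count ℓ S ℕ.+ h ℕ.≤ k

-- If no line meets S in more than k points and |S| = kn, each of the n columns and n rows of the
-- grid meets S in exactly k points, so S is the edge set of a k-regular bipartite graph between
-- x-indices and y-indices. Double counting gives Hall's condition, so the graph has a perfect
-- matching, and deleting it leaves a (k − 1)-regular graph. Deleting k − k' matchings gives
-- S' ⊆ S meeting every row and column in exactly k' points, hence |S'| = k'n. In S' a horizontal
-- or vertical line has at most k' points, a slanted line meeting the grid at most once has at
-- most one (none if k' = 0), and a slanted line ℓ meeting the grid twice has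
-- |S' ∩ ℓ| + h' ≤ |S ∩ ℓ| + h' ≤ k − h + h' = k'.
module Submission where

open import Data.Bool using (if_then_else_; true; false)
open import Data.Empty using (⊥-elim)
open import Data.Fin using (Fin; zero; suc; punchOut; toℕ; fromℕ<)
import Data.Fin.Properties as Fin
open import Data.Fin.Properties using (_≟_; punchOut-injective; <⇒notInjective; toℕ-injective; toℕ-fromℕ<)
open import Data.Fin.Subset
  using (Subset; inside; outside; ⊤; _∈_; _∉_; _⊆_; _∪_; _∩_; _─_; _-_; ⁅_⁆; ∣_∣; Nonempty; Empty)
open import Data.Fin.Subset.Properties
  using (_∈?_; _⊆?_; nonempty?; anySubset?; ∈⊤; x∈⁅x⁆; x∈⁅y⁆⇒x≡y; x∉⁅y⁆⇒x≢y; ⊆-trans; ⊆-antisym;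
         drop-∷-⊆; x∈p∩q⁺; x∈p∩q⁻; x∈p∪q⁺; x∈p∪q⁻; p∩q⊆q; p─q⊆p; x∈p∧x∉q⇒x∈p─q; x∈p∧x≢y⇒x∈p-y;
         ∣p∣≤∣x∷p∣; ∣⁅x⁆∣≡1; ∣⊥∣≡0; Empty-unique; p⊆q⇒∣p∣≤∣q∣; x∈p⇒∣p-x∣<∣p∣; p∩q≢∅⇒∣p─q∣<∣p∣)
open import Data.Integer as ℤ using (ℤ)
import Data.Integer.Properties as ℤP
open import Data.List using (List; []; _∷_; length; filter)
open import Data.List.Membership.Propositional using (find) renaming (_∈_ to _∈ₗ_)
open import Data.List.Membership.Propositional.Properties using (∈-filter⁺; ∈-filter⁻)
open import Data.List.Properties using (filter-none; length-filter)
open import Data.List.Relation.Binary.Sublist.Heterogeneous.Properties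
  using (length-mono-≤; ⊆-filter-Sublist; filter-Sublist)
open import Data.List.Relation.Binary.Sublist.Propositional using (⊆-refl)
open import Data.List.Relation.Unary.All as All using (All; []; _∷_)
open import Data.List.Relation.Unary.All.Properties as All using (All¬⇒¬Any; ¬Any⇒All¬; all-filter)
open import Data.List.Relation.Unary.AllPairs using ([]; _∷_)
open import Data.List.Relation.Unary.Any using (here; there; any?)
open import Data.List.Relation.Unary.Any.Properties using (¬Any[])
open import Data.List.Relation.Unary.Unique.Propositional using (Unique)
import Data.List.Relation.Unary.Unique.Propositional.Properties as Unique
open import Data.Nat using (ℕ; zero; suc; _+_; _*_; _∸_; _≤_; _<_; z≤n; s≤s; _≤?_; _<?_)
import Data.Nat.Properties as ℕP
open import Algebra.Properties.Semiring.Sum ℕP.+-*-semiring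
  using (sum-syntax; ∑-comm; ∑-distrib-+; sum-cong-≗; *-distribˡ-sum; *-distribʳ-sum)
open import Data.Product using (_×_; _,_; proj₁; proj₂; ∃-syntax; uncurry)
open import Data.Product.Properties using (≡-dec; ,-injective)
open import Data.Sum using (_⊎_; inj₁; inj₂)
open import Data.Vec using ([]; _∷_; tabulate; here; there)
open import Data.Vec.Properties using (lookup∘tabulate; []=⇒lookup; lookup⇒[]=)
open import Function using (_∘_; _$_; id; _⇔_; mk⇔; Equivalence)
open import Function.Definitions using (Injective)
open import Relation.Binary.Definitions using (DecidableEquality)
open import Relation.Binary.PropositionalEquality
  using (_≡_; _≢_; refl; sym; trans; cong; cong₂; subst; module ≡-Reasoning)
open import Relation.Nullary using (Dec; yes; no; does; ¬_; contradiction)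
open import Relation.Nullary.Decidable using (dec-true; _×-dec_; ¬?)
open import Relation.Unary using (Pred; Decidable)

open import Defs

[_] : ∀ {p} {P : Set p} → Dec P → ℕ
[ P? ] = if does P? then 1 else 0

[]-cong : ∀ {a b} {A : Set a} {B : Set b} (a? : Dec A) (b? : Dec B) → (A → B) → (B → A) → [ a? ] ≡ [ b? ]
[]-cong (yes _) (yes _) _   _   = refl
[]-cong (no  _) (no  _) _   _   = refl
[]-cong (yes a) (no ¬b) a⇒b _   = contradiction (a⇒b a) ¬b
[]-cong (no ¬a) (yes b) _   b⇒a = contradiction (b⇒a b) ¬a

[]*[]-mono : ∀ {a b c d} {A : Set a} {B : Set b} {C : Set c} {D : Set d}
             (a? : Dec A) (b? : Dec B) (c? : Dec C) (d? : Dec D) →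
             (A → B → C × D) → [ a? ] * [ b? ] ≤ [ c? ] * [ d? ]
[]*[]-mono (no  _) _       _       _       _     = z≤n
[]*[]-mono (yes _) (no  _) _       _       _     = z≤n
[]*[]-mono (yes _) (yes _) (yes _) (yes _) _     = ℕP.≤-refl
[]*[]-mono (yes a) (yes b) (no ¬c) _       ab⇒cd = contradiction (proj₁ (ab⇒cd a b)) ¬c
[]*[]-mono (yes a) (yes b) (yes _) (no ¬d) ab⇒cd = contradiction (proj₂ (ab⇒cd a b)) ¬d

∑-mono-≤ : ∀ {n} {f g : Fin n → ℕ} → (∀ i → f i ≤ g i) → ∑[ i < n ] f i ≤ ∑[ i < n ] g i
∑-mono-≤ {zero}  f≤g = z≤n
∑-mono-≤ {suc n} f≤g = ℕP.+-mono-≤ (f≤g zero) (∑-mono-≤ (f≤g ∘ suc))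

∑-const : ∀ n c → ∑[ i < n ] c ≡ n * c
∑-const zero    c = refl
∑-const (suc n) c = cong (c +_) (∑-const n c)

+-tight : ∀ {a b c d} → a ≤ c → b ≤ d → a + b ≡ c + d → a ≡ c × b ≡ d
+-tight {a} {b} {c} {d} a≤c b≤d eq = a≡c , ℕP.+-cancelˡ-≡ c b d (trans (cong (_+ b) (sym a≡c)) eq)
  where
  a≡c : a ≡ c
  a≡c = ℕP.≤-antisym a≤c (ℕP.+-cancelʳ-≤ d c a (subst (_≤ a + d) eq (ℕP.+-monoʳ-≤ a b≤d)))

∑-tight : ∀ {n k} {f : Fin n → ℕ} → (∀ i → f i ≤ k) → ∑[ i < n ] f i ≡ n * k → ∀ i → f i ≡ k
∑-tight {suc n} {k} {f} f≤k ∑f≡nk = λ where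
    zero    → proj₁ head-and-tail
    (suc i) → ∑-tight (f≤k ∘ suc) (proj₂ head-and-tail) i
  where
  head-and-tail : f zero ≡ k × ∑[ i < n ] f (suc i) ≡ n * k
  head-and-tail = +-tight (f≤k zero) (subst (_ ≤_) (∑-const n k) (∑-mono-≤ (f≤k ∘ suc))) ∑f≡nk

toSubset : ∀ {n p} {P : Pred (Fin n) p} → Decidable P → Subset n
toSubset P? = tabulate (does ∘ P?)

module _ {n p} {P : Pred (Fin n) p} (P? : Decidable P) {x : Fin n} where

  ∈toSubset⁺ : P x → x ∈ toSubset P?
  ∈toSubset⁺ px = lookup⇒[]= x _ (trans (lookup∘tabulate (does ∘ P?) x) (dec-true (P? x) px))

  ∈toSubset⁻ : x ∈ toSubset P? → P x
  ∈toSubset⁻ x∈ with P? x | trans (sym (lookup∘tabulate (does ∘ P?) x)) ([]=⇒lookup x∈)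
  ... | yes px | _ = px

toSubset-cong : ∀ {n p q} {P : Pred (Fin n) p} {Q : Pred (Fin n) q} (P? : Decidable P) (Q? : Decidable Q) →
                (∀ {x} → P x → Q x) → (∀ {x} → Q x → P x) → toSubset P? ≡ toSubset Q?
toSubset-cong P? Q? P⇒Q Q⇒P = ⊆-antisym (∈toSubset⁺ Q? ∘ P⇒Q ∘ ∈toSubset⁻ P?) (∈toSubset⁺ P? ∘ Q⇒P ∘ ∈toSubset⁻ Q?)

Disjoint : ∀ {n} → Subset n → Subset n → Set
Disjoint p q = ∀ {x} → x ∈ p → x ∉ q

drop-∷-Disjoint : ∀ {n} {s t} {p q : Subset n} → Disjoint (s ∷ p) (t ∷ q) → Disjoint p q
drop-∷-Disjoint p∩q=∅ x∈p x∈q = p∩q=∅ (there x∈p) (there x∈q)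

x∈p─q⇒x∉q : ∀ {n} {p q : Subset n} {x} → x ∈ p ─ q → x ∉ q
x∈p─q⇒x∉q {p = _ ∷ _} {outside ∷ _} here          ()
x∈p─q⇒x∉q {p = _ ∷ _} {_ ∷ _}       (there x∈p─q) (there x∈q) = x∈p─q⇒x∉q x∈p─q x∈q

x∈p-y⇒x≢y : ∀ {n} {p : Subset n} {x y} → x ∈ p - y → x ≢ y
x∈p-y⇒x≢y x∈p-y = x∉⁅y⁆⇒x≢y (x∈p─q⇒x∉q x∈p-y)

x∈p⇒⁅x⁆⊆p : ∀ {n} {p : Subset n} {x} → x ∈ p → ⁅ x ⁆ ⊆ p
x∈p⇒⁅x⁆⊆p {p = p} {x} x∈p y∈⁅x⁆ = subst (_∈ p) (sym (x∈⁅y⁆⇒x≡y x y∈⁅x⁆)) x∈p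

∣p∣≡∑ : ∀ {n} (p : Subset n) → ∣ p ∣ ≡ ∑[ i < n ] [ i ∈? p ]
∣p∣≡∑ []            = refl
∣p∣≡∑ (inside ∷ p)  = cong suc (∣p∣≡∑ p)
∣p∣≡∑ (outside ∷ p) = ∣p∣≡∑ p

∑[∈]*c≡∣p∣*c : ∀ {n} (p : Subset n) c → ∑[ i < n ] ([ i ∈? p ] * c) ≡ ∣ p ∣ * c
∑[∈]*c≡∣p∣*c p c = trans (sym (*-distribʳ-sum c (λ i → [ i ∈? p ]))) (cong (_* c) (sym (∣p∣≡∑ p)))

∣p∪q∣≤∣p∣+∣q∣ : ∀ {n} (p q : Subset n) → ∣ p ∪ q ∣ ≤ ∣ p ∣ + ∣ q ∣
∣p∪q∣≤∣p∣+∣q∣ []            []            = z≤n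
∣p∪q∣≤∣p∣+∣q∣ (inside ∷ p)  (t ∷ q)       =
  s≤s (ℕP.≤-trans (∣p∪q∣≤∣p∣+∣q∣ p q) (ℕP.+-monoʳ-≤ ∣ p ∣ (∣p∣≤∣x∷p∣ t q)))
∣p∪q∣≤∣p∣+∣q∣ (outside ∷ p) (inside ∷ q)  =
  subst (suc ∣ p ∪ q ∣ ≤_) (sym (ℕP.+-suc ∣ p ∣ ∣ q ∣)) (s≤s (∣p∪q∣≤∣p∣+∣q∣ p q))
∣p∪q∣≤∣p∣+∣q∣ (outside ∷ p) (outside ∷ q) = ∣p∪q∣≤∣p∣+∣q∣ p q

∣p∪q∣≡∣p∣+∣q∣ : ∀ {n} (p q : Subset n) → Disjoint p q → ∣ p ∪ q ∣ ≡ ∣ p ∣ + ∣ q ∣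
∣p∪q∣≡∣p∣+∣q∣ []            []            _     = refl
∣p∪q∣≡∣p∣+∣q∣ (inside ∷ p)  (inside ∷ q)  p∩q=∅ = contradiction here (p∩q=∅ here)
∣p∪q∣≡∣p∣+∣q∣ (inside ∷ p)  (outside ∷ q) p∩q=∅ = cong suc (∣p∪q∣≡∣p∣+∣q∣ p q (drop-∷-Disjoint p∩q=∅))
∣p∪q∣≡∣p∣+∣q∣ (outside ∷ p) (inside ∷ q)  p∩q=∅ =
  trans (cong suc (∣p∪q∣≡∣p∣+∣q∣ p q (drop-∷-Disjoint p∩q=∅))) (sym (ℕP.+-suc ∣ p ∣ ∣ q ∣))
∣p∪q∣≡∣p∣+∣q∣ (outside ∷ p) (outside ∷ q) p∩q=∅ = ∣p∪q∣≡∣p∣+∣q∣ p q (drop-∷-Disjoint p∩q=∅)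

∣p∣≡∣q∣+∣p─q∣ : ∀ {n} (p q : Subset n) → q ⊆ p → ∣ p ∣ ≡ ∣ q ∣ + ∣ p ─ q ∣
∣p∣≡∣q∣+∣p─q∣ []            []            _   = refl
∣p∣≡∣q∣+∣p─q∣ (inside ∷ p)  (inside ∷ q)  q⊆p = cong suc (∣p∣≡∣q∣+∣p─q∣ p q (drop-∷-⊆ q⊆p))
∣p∣≡∣q∣+∣p─q∣ (inside ∷ p)  (outside ∷ q) q⊆p =
  trans (cong suc (∣p∣≡∣q∣+∣p─q∣ p q (drop-∷-⊆ q⊆p))) (sym (ℕP.+-suc ∣ q ∣ ∣ p ─ q ∣))
∣p∣≡∣q∣+∣p─q∣ (outside ∷ p) (inside ∷ q)  q⊆p with () ← q⊆p here
∣p∣≡∣q∣+∣p─q∣ (outside ∷ p) (outside ∷ q) q⊆p = ∣p∣≡∣q∣+∣p─q∣ p q (drop-∷-⊆ q⊆p)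

x∈p⇒∣p∣≡1+∣p-x∣ : ∀ {n} {p : Subset n} {x} → x ∈ p → ∣ p ∣ ≡ suc ∣ p - x ∣
x∈p⇒∣p∣≡1+∣p-x∣ {p = p} {x} x∈p =
  trans (∣p∣≡∣q∣+∣p─q∣ p ⁅ x ⁆ (x∈p⇒⁅x⁆⊆p x∈p)) (cong (_+ ∣ p - x ∣) (∣⁅x⁆∣≡1 x))

x∈p⇒0<∣p∣ : ∀ {n} {p : Subset n} {x} → x ∈ p → 0 < ∣ p ∣
x∈p⇒0<∣p∣ x∈p = ℕP.<-≤-trans (s≤s z≤n) (x∈p⇒∣p-x∣<∣p∣ x∈p)

Empty⇒∣p∣≡0 : ∀ {n} {p : Subset n} → Empty p → ∣ p ∣ ≡ 0
Empty⇒∣p∣≡0 {n} p=∅ = trans (cong ∣_∣ (Empty-unique p=∅)) (∣⊥∣≡0 n)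

0<∣p∣⇒Nonempty : ∀ {n} {p : Subset n} → 0 < ∣ p ∣ → Nonempty p
0<∣p∣⇒Nonempty {p = p} 0<∣p∣ with nonempty? p
... | yes p≠∅ = p≠∅
... | no  p=∅ = contradiction (Empty⇒∣p∣≡0 p=∅) (ℕP.>⇒≢ 0<∣p∣)

injective⇒surjective : ∀ {n} {f : Fin n → Fin n} → Injective _≡_ _≡_ f → ∀ j → ∃[ i ] f i ≡ j
injective⇒surjective {suc n} {f} f-injective j with Fin.any? (λ i → f i ≟ j)
... | yes hit  = hit
... | no  miss = contradiction
  (λ {_} {_} eq → f-injective (punchOut-injective (j≢f _) (j≢f _) eq))
  (<⇒notInjective {f = λ i → punchOut (j≢f i)} ℕP.≤-refl)
  where
  j≢f : ∀ i → j ≢ f i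
  j≢f i j≡fi = miss (i , sym j≡fi)

-- Hall's theorem

module Hall {m n} (E : Fin m → Subset n) where

  adjacentTo? : (A : Subset m) → Decidable (λ j → ∃[ i ] i ∈ A × j ∈ E i)
  adjacentTo? A j = Fin.any? (λ i → i ∈? A ×-dec j ∈? E i)

  neighbours : Subset m → Subset n
  neighbours A = toSubset (adjacentTo? A)

  ∈neighbours⁺ : ∀ {A i j} → i ∈ A → j ∈ E i → j ∈ neighbours A
  ∈neighbours⁺ {A} i∈A j∈Ei = ∈toSubset⁺ (adjacentTo? A) (_ , i∈A , j∈Ei)

  ∈neighbours⁻ : ∀ {A j} → j ∈ neighbours A → ∃[ i ] i ∈ A × j ∈ E i
  ∈neighbours⁻ {A} = ∈toSubset⁻ (adjacentTo? A)

  neighbours-mono : ∀ {A B} → A ⊆ B → neighbours A ⊆ neighbours B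
  neighbours-mono A⊆B j∈NA with i , i∈A , j∈Ei ← ∈neighbours⁻ j∈NA = ∈neighbours⁺ (A⊆B i∈A) j∈Ei

  HallCondition : Subset m → Subset n → Set
  HallCondition L C = ∀ A → A ⊆ L → ∣ A ∣ ≤ ∣ neighbours A ∩ C ∣

  record Matching (L : Subset m) (C : Subset n) : Set where
    field
      partner           : ∀ {i} → i ∈ L → Fin n
      partner∈E         : ∀ {i} (i∈L : i ∈ L) → partner i∈L ∈ E i
      partner∈C         : ∀ {i} (i∈L : i ∈ L) → partner i∈L ∈ C
      partner-injective : ∀ {i j} (i∈L : i ∈ L) (j∈L : j ∈ L) → partner i∈L ≡ partner j∈L → i ≡ j

  emptyMatching : ∀ {L C} → Empty L → Matching L C
  emptyMatching L=∅ = record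
    { partner           = λ i∈L → ⊥-elim (L=∅ (_ , i∈L))
    ; partner∈E         = λ i∈L → ⊥-elim (L=∅ (_ , i∈L))
    ; partner∈C         = λ i∈L → ⊥-elim (L=∅ (_ , i∈L))
    ; partner-injective = λ i∈L → ⊥-elim (L=∅ (_ , i∈L))
    }

  singletonMatching : ∀ {i j} → j ∈ E i → Matching ⁅ i ⁆ ⁅ j ⁆
  singletonMatching {i} {j} j∈Ei = record
    { partner           = λ _ → j
    ; partner∈E         = λ i′∈⁅i⁆ → subst (λ i′ → j ∈ E i′) (sym (x∈⁅y⁆⇒x≡y i i′∈⁅i⁆)) j∈Ei
    ; partner∈C         = λ _ → x∈⁅x⁆ j
    ; partner-injective = λ i₁∈⁅i⁆ i₂∈⁅i⁆ _ → trans (x∈⁅y⁆⇒x≡y i i₁∈⁅i⁆) (sym (x∈⁅y⁆⇒x≡y i i₂∈⁅i⁆))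
    }

  Matching-∪ : ∀ {L C C₁ C₂} (A : Subset m) → C₁ ⊆ C → C₂ ⊆ C → Disjoint C₁ C₂ →
               Matching A C₁ → Matching (L ─ A) C₂ → Matching L C
  Matching-∪ {L} {C} {C₁} {C₂} A C₁⊆C C₂⊆C C₁∩C₂=∅ M₁ M₂ = record
    { partner = partner ; partner∈E = partner∈E ; partner∈C = partner∈C ; partner-injective = partner-injective }
    where
    module M₁ = Matching M₁
    module M₂ = Matching M₂

    partner : ∀ {i} → i ∈ L → Fin n
    partner {i} i∈L with i ∈? A
    ... | yes i∈A = M₁.partner i∈A
    ... | no  i∉A = M₂.partner (x∈p∧x∉q⇒x∈p─q i∈L i∉A)

    partner∈E : ∀ {i} (i∈L : i ∈ L) → partner i∈L ∈ E i
    partner∈E {i} i∈L with i ∈? A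
    ... | yes i∈A = M₁.partner∈E i∈A
    ... | no  i∉A = M₂.partner∈E (x∈p∧x∉q⇒x∈p─q i∈L i∉A)

    partner∈C : ∀ {i} (i∈L : i ∈ L) → partner i∈L ∈ C
    partner∈C {i} i∈L with i ∈? A
    ... | yes i∈A = C₁⊆C (M₁.partner∈C i∈A)
    ... | no  i∉A = C₂⊆C (M₂.partner∈C (x∈p∧x∉q⇒x∈p─q i∈L i∉A))

    partner-injective : ∀ {i j} (i∈L : i ∈ L) (j∈L : j ∈ L) → partner i∈L ≡ partner j∈L → i ≡ j
    partner-injective {i} {j} i∈L j∈L with i ∈? A | j ∈? A
    ... | yes i∈A | yes j∈A = M₁.partner-injective i∈A j∈A
    ... | no  i∉A | no  j∉A = M₂.partner-injective (x∈p∧x∉q⇒x∈p─q i∈L i∉A) (x∈p∧x∉q⇒x∈p─q j∈L j∉A)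
    ... | yes i∈A | no  j∉A = λ eq → ⊥-elim $
      C₁∩C₂=∅ (M₁.partner∈C i∈A) (subst (_∈ C₂) (sym eq) (M₂.partner∈C (x∈p∧x∉q⇒x∈p─q j∈L j∉A)))
    ... | no  i∉A | yes j∈A = λ eq → ⊥-elim $
      C₁∩C₂=∅ (M₁.partner∈C j∈A) (subst (_∈ C₂) eq (M₂.partner∈C (x∈p∧x∉q⇒x∈p─q i∈L i∉A)))

  Critical : Subset m → Subset n → Subset m → Set
  Critical L C A = A ⊆ L × Nonempty A × ∣ A ∣ < ∣ L ∣ × ∣ neighbours A ∩ C ∣ ≤ ∣ A ∣

  critical? : ∀ L C → Decidable (Critical L C)
  critical? L C A = A ⊆? L ×-dec nonempty? A ×-dec ∣ A ∣ <? ∣ L ∣ ×-dec ∣ neighbours A ∩ C ∣ ≤? ∣ A ∣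

  hallCondition⇒neighbour : ∀ {L C i} → HallCondition L C → i ∈ L → ∃[ j ] j ∈ E i × j ∈ C
  hallCondition⇒neighbour {L} {C} {i} hc i∈L
    with j , j∈N⁅i⁆∩C ← 0<∣p∣⇒Nonempty (subst (_≤ ∣ neighbours ⁅ i ⁆ ∩ C ∣) (∣⁅x⁆∣≡1 i) (hc ⁅ i ⁆ (x∈p⇒⁅x⁆⊆p i∈L)))
    with j∈N⁅i⁆ , j∈C ← x∈p∩q⁻ _ _ j∈N⁅i⁆∩C
    with i′ , i′∈⁅i⁆ , j∈Ei′ ← ∈neighbours⁻ j∈N⁅i⁆
    = j , subst (λ i′ → j ∈ E i′) (x∈⁅y⁆⇒x≡y i i′∈⁅i⁆) j∈Ei′ , j∈C

  hallCondition-inside : ∀ {L C A} → HallCondition L C → A ⊆ L → HallCondition A (neighbours A ∩ C)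
  hallCondition-inside {L} {C} {A} hc A⊆L B B⊆A =
    ℕP.≤-trans (hc B (⊆-trans B⊆A A⊆L)) (p⊆q⇒∣p∣≤∣q∣ NB∩C⊆NB∩NA∩C)
    where
    NB∩C⊆NB∩NA∩C : neighbours B ∩ C ⊆ neighbours B ∩ (neighbours A ∩ C)
    NB∩C⊆NB∩NA∩C j∈ with j∈NB , j∈C ← x∈p∩q⁻ _ _ j∈ =
      x∈p∩q⁺ (j∈NB , x∈p∩q⁺ (neighbours-mono B⊆A j∈NB , j∈C))

  hallCondition-outside : ∀ {L C A} → HallCondition L C → A ⊆ L → ∣ neighbours A ∩ C ∣ ≤ ∣ A ∣ →
                          HallCondition (L ─ A) (C ─ neighbours A)
  hallCondition-outside {L} {C} {A} hc A⊆L A-critical B B⊆L─A = ℕP.+-cancelʳ-≤ ∣ A ∣ _ _ (begin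
    ∣ B ∣ + ∣ A ∣                  ≡⟨ ∣p∪q∣≡∣p∣+∣q∣ B A (λ x∈B → x∈p─q⇒x∉q (B⊆L─A x∈B)) ⟨
    ∣ B ∪ A ∣                      ≤⟨ hc (B ∪ A) B∪A⊆L ⟩
    ∣ neighbours (B ∪ A) ∩ C ∣     ≤⟨ p⊆q⇒∣p∣≤∣q∣ split ⟩
    ∣ NB′ ∪ neighbours A ∩ C ∣     ≤⟨ ∣p∪q∣≤∣p∣+∣q∣ NB′ _ ⟩
    ∣ NB′ ∣ + ∣ neighbours A ∩ C ∣ ≤⟨ ℕP.+-monoʳ-≤ ∣ NB′ ∣ A-critical ⟩
    ∣ NB′ ∣ + ∣ A ∣                ∎)
    where
    open ℕP.≤-Reasoning
    NB′ = neighbours B ∩ (C ─ neighbours A)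
    B∪A⊆L : B ∪ A ⊆ L
    B∪A⊆L x∈B∪A with x∈p∪q⁻ B A x∈B∪A
    ... | inj₁ x∈B = p─q⊆p L A (B⊆L─A x∈B)
    ... | inj₂ x∈A = A⊆L x∈A
    split : neighbours (B ∪ A) ∩ C ⊆ NB′ ∪ neighbours A ∩ C
    split {j} j∈ with j∈N[B∪A] , j∈C ← x∈p∩q⁻ _ _ j∈ with j ∈? neighbours A
    ... | yes j∈NA = x∈p∪q⁺ (inj₂ (x∈p∩q⁺ (j∈NA , j∈C)))
    ... | no  j∉NA with i , i∈B∪A , j∈Ei ← ∈neighbours⁻ j∈N[B∪A] with x∈p∪q⁻ B A i∈B∪A
    ...   | inj₁ i∈B = x∈p∪q⁺ (inj₁ (x∈p∩q⁺ (∈neighbours⁺ i∈B j∈Ei , x∈p∧x∉q⇒x∈p─q j∈C j∉NA)))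
    ...   | inj₂ i∈A = contradiction (∈neighbours⁺ i∈A j∈Ei) j∉NA

  hallCondition-remove : ∀ {L C i j} → i ∈ L → (∀ A → ¬ Critical L C A) → HallCondition (L - i) (C - j)
  hallCondition-remove {L} {C} {i} {j} i∈L no-critical B B⊆L-i with nonempty? B
  ... | no  B=∅ = subst (_≤ ∣ neighbours B ∩ (C - j) ∣) (sym (Empty⇒∣p∣≡0 B=∅)) z≤n
  ... | yes B≠∅ = ℕP.≤-pred (begin
    suc ∣ B ∣             ≤⟨ ℕP.≰⇒> (λ B-critical → no-critical B (B⊆L , B≠∅ , ∣B∣<∣L∣ , B-critical)) ⟩
    ∣ neighbours B ∩ C ∣  ≤⟨ p⊆q⇒∣p∣≤∣q∣ split ⟩
    ∣ NB′ ∪ ⁅ j ⁆ ∣       ≤⟨ ∣p∪q∣≤∣p∣+∣q∣ NB′ ⁅ j ⁆ ⟩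
    ∣ NB′ ∣ + ∣ ⁅ j ⁆ ∣    ≡⟨ cong (∣ NB′ ∣ +_) (∣⁅x⁆∣≡1 j) ⟩
    ∣ NB′ ∣ + 1           ≡⟨ ℕP.+-comm ∣ NB′ ∣ 1 ⟩
    suc ∣ NB′ ∣           ∎)
    where
    open ℕP.≤-Reasoning
    NB′ = neighbours B ∩ (C - j)
    B⊆L : B ⊆ L
    B⊆L = p─q⊆p L ⁅ i ⁆ ∘ B⊆L-i
    ∣B∣<∣L∣ : ∣ B ∣ < ∣ L ∣
    ∣B∣<∣L∣ = ℕP.≤-<-trans (p⊆q⇒∣p∣≤∣q∣ B⊆L-i) (x∈p⇒∣p-x∣<∣p∣ i∈L)
    split : neighbours B ∩ C ⊆ NB′ ∪ ⁅ j ⁆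
    split {j′} j′∈ with j′∈NB , j′∈C ← x∈p∩q⁻ _ _ j′∈ with j′ ≟ j
    ... | yes refl = x∈p∪q⁺ (inj₂ (x∈⁅x⁆ j))
    ... | no  j′≢j = x∈p∪q⁺ (inj₁ (x∈p∩q⁺ (j′∈NB , x∈p∧x≢y⇒x∈p-y j′∈C j′≢j)))

  -- Halmos–Vaughan: if some nonempty proper A ⊆ L is critical, match A into N(A) and L − A into
  -- C − N(A) separately; otherwise every such A has surplus, so any edge at i can be matched and
  -- Hall's condition survives the removal of its endpoints.
  hall-bounded : ∀ b {L C} → ∣ L ∣ ≤ b → HallCondition L C → Matching L C
  hall-bounded zero    ∣L∣≤0 _ = emptyMatching (λ (_ , i∈L) → ℕP.≤⇒≯ ∣L∣≤0 (x∈p⇒0<∣p∣ i∈L))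
  hall-bounded (suc b) {L} {C} ∣L∣≤1+b hc with nonempty? L
  ... | no  L=∅ = emptyMatching L=∅
  ... | yes (i , i∈L) with anySubset? (critical? L C)
  ...   | yes (A , A⊆L , A≠∅ , ∣A∣<∣L∣ , A-critical) =
    Matching-∪ A (p∩q⊆q _ _) (p─q⊆p _ _) (λ j∈NA∩C j∈C─NA → x∈p─q⇒x∉q j∈C─NA (proj₁ (x∈p∩q⁻ _ _ j∈NA∩C)))
      (hall-bounded b (ℕP.≤-pred (ℕP.<-≤-trans ∣A∣<∣L∣ ∣L∣≤1+b)) (hallCondition-inside hc A⊆L))
      (hall-bounded b (ℕP.≤-pred (ℕP.<-≤-trans ∣L─A∣<∣L∣ ∣L∣≤1+b)) (hallCondition-outside hc A⊆L A-critical))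
    where
    ∣L─A∣<∣L∣ : ∣ L ─ A ∣ < ∣ L ∣
    ∣L─A∣<∣L∣ = let a , a∈A = A≠∅ in p∩q≢∅⇒∣p─q∣<∣p∣ L A (a , x∈p∩q⁺ (A⊆L a∈A , a∈A))
  ...   | no  no-critical with j , j∈Ei , j∈C ← hallCondition⇒neighbour hc i∈L =
    Matching-∪ ⁅ i ⁆ (x∈p⇒⁅x⁆⊆p j∈C) (p─q⊆p _ _) (λ j′∈⁅j⁆ j′∈C-j → x∈p─q⇒x∉q j′∈C-j j′∈⁅j⁆)
      (singletonMatching j∈Ei)
      (hall-bounded b (ℕP.≤-pred (ℕP.<-≤-trans (x∈p⇒∣p-x∣<∣p∣ i∈L) ∣L∣≤1+b))
        (hallCondition-remove i∈L (λ A A-critical → no-critical (A , A-critical))))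

  hall : ∀ {L C} → HallCondition L C → Matching L C
  hall {L} = hall-bounded ∣ L ∣ ℕP.≤-refl

-- Regular bipartite graphs

column : ∀ {m n} → (Fin m → Subset n) → Fin n → Subset m
column E j = toSubset (λ i → j ∈? E i)

module _ {m n} {E : Fin m → Subset n} {i : Fin m} {j : Fin n} where

  ∈column⁺ : j ∈ E i → i ∈ column E j
  ∈column⁺ = ∈toSubset⁺ (λ i → j ∈? E i)

  ∈column⁻ : i ∈ column E j → j ∈ E i
  ∈column⁻ = ∈toSubset⁻ (λ i → j ∈? E i)

column-cong : ∀ {m n} {E F : Fin m → Subset n} → (∀ i → E i ≡ F i) → ∀ j → column E j ≡ column F j
column-cong {E = E} {F} E≡F j =
  toSubset-cong (λ i → j ∈? E i) (λ i → j ∈? F i) (λ {i} → subst (j ∈_) (E≡F i)) (λ {i} → subst (j ∈_) (sym (E≡F i)))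

∑∣row∣≡∑∣column∣ : ∀ {m n} (E : Fin m → Subset n) → ∑[ i < m ] ∣ E i ∣ ≡ ∑[ j < n ] ∣ column E j ∣
∑∣row∣≡∑∣column∣ {m} {n} E = begin
  ∑[ i < m ] ∣ E i ∣                         ≡⟨ sum-cong-≗ (∣p∣≡∑ ∘ E) ⟩
  ∑[ i < m ] ∑[ j < n ] [ j ∈? E i ]          ≡⟨ ∑-comm (λ i j → [ j ∈? E i ]) ⟩
  ∑[ j < n ] ∑[ i < m ] [ j ∈? E i ]          ≡⟨ sum-cong-≗ (λ j → sum-cong-≗ (λ i →
                                                   []-cong (j ∈? E i) (i ∈? column E j) ∈column⁺ ∈column⁻)) ⟩
  ∑[ j < n ] ∑[ i < m ] [ i ∈? column E j ]   ≡⟨ sum-cong-≗ (sym ∘ ∣p∣≡∑ ∘ column E) ⟩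
  ∑[ j < n ] ∣ column E j ∣                   ∎
  where open ≡-Reasoning

edges : ∀ {m n} → (Fin m → Subset n) → Subset m → ℕ
edges {m} E A = ∑[ i < m ] ([ i ∈? A ] * ∣ E i ∣)

edges≡∑∑ : ∀ {m n} (E : Fin m → Subset n) A → edges E A ≡ ∑[ i < m ] ∑[ j < n ] ([ i ∈? A ] * [ j ∈? E i ])
edges≡∑∑ E A = sum-cong-≗ λ i →
  trans (cong ([ i ∈? A ] *_) (∣p∣≡∑ (E i))) (*-distribˡ-sum [ i ∈? A ] (λ j → [ j ∈? E i ]))

edges-regular : ∀ {m n k} (E : Fin m → Subset n) A → (∀ i → ∣ E i ∣ ≡ k) → edges E A ≡ ∣ A ∣ * k
edges-regular {k = k} E A ∣E∣≡k = trans (sum-cong-≗ (λ i → cong ([ i ∈? A ] *_) (∣E∣≡k i))) (∑[∈]*c≡∣p∣*c A k)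

edges≤edges-column : ∀ {m n} (E : Fin m → Subset n) A → edges E A ≤ edges (column E) (Hall.neighbours E A)
edges≤edges-column {m} {n} E A = begin
  edges E A                                                  ≡⟨ edges≡∑∑ E A ⟩
  ∑[ i < m ] ∑[ j < n ] ([ i ∈? A ] * [ j ∈? E i ])           ≤⟨ ∑-mono-≤ (λ i → ∑-mono-≤ (λ j →
      []*[]-mono (i ∈? A) (j ∈? E i) (j ∈? N A) (i ∈? column E j)
        (λ i∈A j∈Ei → ∈neighbours⁺ i∈A j∈Ei , ∈column⁺ j∈Ei))) ⟩
  ∑[ i < m ] ∑[ j < n ] ([ j ∈? N A ] * [ i ∈? column E j ])  ≡⟨ ∑-comm (λ i j → [ j ∈? N A ] * [ i ∈? column E j ]) ⟩
  ∑[ j < n ] ∑[ i < m ] ([ j ∈? N A ] * [ i ∈? column E j ])  ≡⟨ edges≡∑∑ (column E) (N A) ⟨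
  edges (column E) (N A)                                     ∎
  where
  open ℕP.≤-Reasoning
  open Hall E renaming (neighbours to N)

Regular : ∀ {n} → ℕ → (Fin n → Subset n) → Set
Regular k E = (∀ i → ∣ E i ∣ ≡ k) × (∀ j → ∣ column E j ∣ ≡ k)

Regular-cong : ∀ {n k} {E F : Fin n → Subset n} → (∀ i → E i ≡ F i) → Regular k E → Regular k F
Regular-cong E≡F (∣row∣≡ , ∣column∣≡) =
  (λ i → trans (cong ∣_∣ (sym (E≡F i))) (∣row∣≡ i)) , (λ j → trans (cong ∣_∣ (sym (column-cong E≡F j))) (∣column∣≡ j))

regular⇒hallCondition : ∀ {n k} {E : Fin n → Subset n} → Regular (suc k) E → Hall.HallCondition E ⊤ ⊤
regular⇒hallCondition {k = k} {E} (∣row∣≡ , ∣column∣≡) A _ = begin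
  ∣ A ∣                 ≤⟨ ℕP.*-cancelʳ-≤ ∣ A ∣ ∣ N A ∣ (suc k) (begin
                             ∣ A ∣ * suc k            ≡⟨ edges-regular E A ∣row∣≡ ⟨
                             edges E A                ≤⟨ edges≤edges-column E A ⟩
                             edges (column E) (N A)   ≡⟨ edges-regular (column E) (N A) ∣column∣≡ ⟩
                             ∣ N A ∣ * suc k          ∎) ⟩
  ∣ N A ∣               ≤⟨ p⊆q⇒∣p∣≤∣q∣ {p = N A} (λ j∈NA → x∈p∩q⁺ (j∈NA , ∈⊤)) ⟩
  ∣ N A ∩ ⊤ ∣           ∎
  where
  open ℕP.≤-Reasoning
  open Hall E renaming (neighbours to N)

column-removeMatching : ∀ {n} (E : Fin n → Subset n) {f g : Fin n → Fin n} → Injective _≡_ _≡_ f → (∀ j → f (g j) ≡ j) →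
                        ∀ j → column (λ i → E i - f i) j ≡ column E j - g j
column-removeMatching E {f} {g} f-injective f∘g j = ⊆-antisym
  (λ {i} i∈ → let j∈Ei-fi = ∈column⁻ i∈ in
    x∈p∧x≢y⇒x∈p-y (∈column⁺ (p─q⊆p _ _ j∈Ei-fi)) (λ { refl → x∈p-y⇒x≢y j∈Ei-fi (sym (f∘g j)) }))
  (λ {i} i∈ →
    ∈column⁺ (x∈p∧x≢y⇒x∈p-y (∈column⁻ (p─q⊆p _ _ i∈))
      (λ j≡fi → x∈p-y⇒x≢y i∈ (f-injective (trans (sym j≡fi) (sym (f∘g j)))))))

regular-removeMatching : ∀ {n k} {E : Fin n → Subset n} → Regular (suc k) E →
                         ∃[ E′ ] (∀ i → E′ i ⊆ E i) × Regular k E′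
regular-removeMatching {n} {k} {E} regular@(∣row∣≡ , ∣column∣≡) =
  (λ i → E i - f i) , (λ i → p─q⊆p (E i) ⁅ f i ⁆) , ∣row′∣≡ , ∣column′∣≡
  where
  open Hall.Matching (Hall.hall E (regular⇒hallCondition regular))
  f : Fin n → Fin n
  f i = partner (∈⊤ {x = i})
  f-injective : Injective _≡_ _≡_ f
  f-injective = partner-injective ∈⊤ ∈⊤
  g : Fin n → Fin n
  g j = proj₁ (injective⇒surjective f-injective j)
  f∘g : ∀ j → f (g j) ≡ j
  f∘g j = proj₂ (injective⇒surjective f-injective j)
  ∣row′∣≡ : ∀ i → ∣ E i - f i ∣ ≡ k
  ∣row′∣≡ i = ℕP.suc-injective (trans (sym (x∈p⇒∣p∣≡1+∣p-x∣ (partner∈E ∈⊤))) (∣row∣≡ i))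
  ∣column′∣≡ : ∀ j → ∣ column (λ i → E i - f i) j ∣ ≡ k
  ∣column′∣≡ j = ℕP.suc-injective (begin
    suc ∣ column (λ i → E i - f i) j ∣  ≡⟨ cong (suc ∘ ∣_∣) (column-removeMatching E f-injective f∘g j) ⟩
    suc ∣ column E j - g j ∣           ≡⟨ x∈p⇒∣p∣≡1+∣p-x∣ {p = column E j} g[j]∈column ⟨
    ∣ column E j ∣                     ≡⟨ ∣column∣≡ j ⟩
    suc k                              ∎)
    where
    open ≡-Reasoning
    g[j]∈column : g j ∈ column E j
    g[j]∈column = ∈column⁺ (subst (_∈ E (g j)) (f∘g j) (partner∈E ∈⊤))

regular-subgraph : ∀ d {n k} {E : Fin n → Subset n} → Regular (d + k) E → ∃[ E′ ] (∀ i → E′ i ⊆ E i) × Regular k E′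
regular-subgraph zero    {E = E} regular = E , (λ _ → id) , regular
regular-subgraph (suc d) regular
  with E₁ , E₁⊆E , regular₁ ← regular-removeMatching regular
  with E₂ , E₂⊆E₁ , regular₂ ← regular-subgraph d regular₁
  = E₂ , (λ i → E₁⊆E i ∘ E₂⊆E₁ i) , regular₂

length-filter-∷ : ∀ {a p} {A : Set a} {P : Pred A p} (P? : Decidable P) x xs →
                  length (filter P? (x ∷ xs)) ≡ [ P? x ] + length (filter P? xs)
length-filter-∷ P? x xs with does (P? x)
... | true  = refl
... | false = refl

length-filter-mono : ∀ {a p q} {A : Set a} {P : Pred A p} {Q : Pred A q} (P? : Decidable P) (Q? : Decidable Q) →
                     (∀ {x} → P x → Q x) → ∀ xs → length (filter P? xs) ≤ length (filter Q? xs)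
length-filter-mono P? Q? P⇒Q xs = length-mono-≤ (⊆-filter-Sublist P? Q? (λ { refl p → P⇒Q p }) (⊆-refl {x = xs}))

length-filter-filter≤ : ∀ {a p q} {A : Set a} {P : Pred A p} {Q : Pred A q} (P? : Decidable P) (Q? : Decidable Q) xs →
                        length (filter Q? (filter P? xs)) ≤ length (filter Q? xs)
length-filter-filter≤ P? Q? xs =
  length-mono-≤ (⊆-filter-Sublist Q? Q? (λ { refl q → q }) (filter-Sublist P? (⊆-refl {x = xs})))

length≡∑length-filter : ∀ {a p m} {A : Set a} {P : Fin m → Pred A p} (P? : ∀ i → Decidable (P i)) xs →
                        All (λ x → ∑[ i < m ] [ P? i x ] ≡ 1) xs → length xs ≡ ∑[ i < m ] length (filter (P? i) xs)
length≡∑length-filter {m = m} P? []       []             = sym (trans (∑-const m 0) (ℕP.*-zeroʳ m))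
length≡∑length-filter {m = m} P? (x ∷ xs) (once ∷ onces) = begin
  suc (length xs)                                               ≡⟨ cong₂ _+_ (sym once) (length≡∑length-filter P? xs onces) ⟩
  ∑[ i < m ] [ P? i x ] + ∑[ i < m ] length (filter (P? i) xs)  ≡⟨ ∑-distrib-+ (λ i → [ P? i x ]) _ ⟨
  ∑[ i < m ] ([ P? i x ] + length (filter (P? i) xs))           ≡⟨ sum-cong-≗ (λ i → length-filter-∷ (P? i) x xs) ⟨
  ∑[ i < m ] length (filter (P? i) (x ∷ xs))                    ∎
  where open ≡-Reasoning

module _ {a} {A : Set a} (_≟ₐ_ : DecidableEquality A) where
  open import Data.List.Membership.DecPropositional _≟ₐ_ using () renaming (_∈?_ to _∈ₗ?_)

  length≡∣enumerated∣ : ∀ {n} {e : Fin n → A} → Injective _≡_ _≡_ e → ∀ {xs} → Unique xs →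
                        All (λ x → ∃[ t ] e t ≡ x) xs → length xs ≡ ∣ toSubset (λ t → e t ∈ₗ? xs) ∣
  length≡∣enumerated∣ {e = e} _ {[]} [] [] =
    sym (Empty⇒∣p∣≡0 (λ (_ , t∈) → ¬Any[] (∈toSubset⁻ (λ t → e t ∈ₗ? []) t∈)))
  length≡∣enumerated∣ {n} {e} e-injective {_ ∷ xs} (e₀∉xs ∷ unique) ((t₀ , refl) ∷ enumerated) = begin
    suc (length xs)        ≡⟨ cong suc (length≡∣enumerated∣ e-injective unique enumerated) ⟩
    suc ∣ T xs ∣           ≡⟨ cong (_+ ∣ T xs ∣) (∣⁅x⁆∣≡1 t₀) ⟨
    ∣ ⁅ t₀ ⁆ ∣ + ∣ T xs ∣  ≡⟨ ∣p∪q∣≡∣p∣+∣q∣ ⁅ t₀ ⁆ (T xs) disjoint ⟨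
    ∣ ⁅ t₀ ⁆ ∪ T xs ∣      ≡⟨ cong ∣_∣ (⊆-antisym ⊆T ⊇T) ⟩
    ∣ T (e t₀ ∷ xs) ∣      ∎
    where
    open ≡-Reasoning
    T : List A → Subset n
    T ys = toSubset (λ t → e t ∈ₗ? ys)
    disjoint : Disjoint ⁅ t₀ ⁆ (T xs)
    disjoint t∈⁅t₀⁆ t∈T = All¬⇒¬Any e₀∉xs
      (subst (_∈ₗ xs) (cong e (x∈⁅y⁆⇒x≡y t₀ t∈⁅t₀⁆)) (∈toSubset⁻ (λ t → e t ∈ₗ? xs) t∈T))
    ⊆T : ⁅ t₀ ⁆ ∪ T xs ⊆ T (e t₀ ∷ xs)
    ⊆T {t} t∈ with x∈p∪q⁻ ⁅ t₀ ⁆ (T xs) t∈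
    ... | inj₁ t∈⁅t₀⁆ = ∈toSubset⁺ (λ t → e t ∈ₗ? (e t₀ ∷ xs)) (here (cong e (x∈⁅y⁆⇒x≡y t₀ t∈⁅t₀⁆)))
    ... | inj₂ t∈T    = ∈toSubset⁺ (λ t → e t ∈ₗ? (e t₀ ∷ xs)) (there (∈toSubset⁻ (λ t → e t ∈ₗ? xs) t∈T))
    ⊇T : T (e t₀ ∷ xs) ⊆ ⁅ t₀ ⁆ ∪ T xs
    ⊇T {t} t∈ with ∈toSubset⁻ (λ t → e t ∈ₗ? (e t₀ ∷ xs)) t∈
    ... | here  et≡et₀ = x∈p∪q⁺ (inj₁ (subst (_∈ ⁅ t₀ ⁆) (sym (e-injective et≡et₀)) (x∈⁅x⁆ t₀)))
    ... | there et∈xs  = x∈p∪q⁺ (inj₂ (∈toSubset⁺ (λ t → e t ∈ₗ? xs) et∈xs))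

-- The grid

_≟ᵖ_ : DecidableEquality Point
_≟ᵖ_ = ≡-dec ℤ._≟_ ℤ._≟_

open import Data.List.Membership.DecPropositional _≟ᵖ_ using () renaming (_∈?_ to _∈ₗ?_)

coord : ∀ {n} → Fin n → ℤ
coord i = ℤ.+ suc (toℕ i)

coord-injective : ∀ {n} → Injective _≡_ _≡_ (coord {n})
coord-injective = toℕ-injective ∘ ℕP.suc-injective ∘ ℤP.+-injective

inRange⇒coord : ∀ {n x} → ℤ.+ 1 ℤ.≤ x → x ℤ.≤ ℤ.+ n → ∃[ i ] coord {n} i ≡ x
inRange⇒coord {x = ℤ.+ zero}  (ℤ.+≤+ ())
inRange⇒coord {x = ℤ.+ suc m} _ (ℤ.+≤+ m<n) = fromℕ< m<n , cong (ℤ.+_ ∘ suc) (toℕ-fromℕ< m<n)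

point : ∀ {n} → Fin n → Fin n → Point
point i j = coord i , coord j

point-injective : ∀ {n} {i i′ j j′ : Fin n} → point i j ≡ point i′ j′ → i ≡ i′ × j ≡ j′
point-injective eq with x≡ , y≡ ← ,-injective eq = coord-injective x≡ , coord-injective y≡

inGrid⇒point : ∀ {n p} → InGrid n p → ∃[ i ] ∃[ j ] point {n} i j ≡ p
inGrid⇒point ((1≤x , x≤n) , (1≤y , y≤n))
  with i , refl ← inRange⇒coord 1≤x x≤n
  with j , refl ← inRange⇒coord 1≤y y≤n
  = i , j , refl

vertical : ℤ → Line
vertical x₀ = line (ℤ.+ 1) (ℤ.+ 0) x₀ (λ ())

horizontal : ℤ → Line
horizontal y₀ = line (ℤ.+ 0) (ℤ.+ 1) y₀ (λ ())

onVertical⇔ : ∀ {x₀ x y} → OnLine (vertical x₀) (x , y) ⇔ x ≡ x₀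
onVertical⇔ {x₀} {x} {y} = mk⇔ (trans (sym lhs≡x)) (trans lhs≡x)
  where
  lhs≡x : ℤ.+ 1 ℤ.* x ℤ.+ ℤ.+ 0 ℤ.* y ≡ x
  lhs≡x = trans (ℤP.+-identityʳ (ℤ.+ 1 ℤ.* x)) (ℤP.*-identityˡ x)

onHorizontal⇔ : ∀ {y₀ x y} → OnLine (horizontal y₀) (x , y) ⇔ y ≡ y₀
onHorizontal⇔ {y₀} {x} {y} = mk⇔ (trans (sym lhs≡y)) (trans lhs≡y)
  where
  lhs≡y : ℤ.+ 0 ℤ.* x ℤ.+ ℤ.+ 1 ℤ.* y ≡ y
  lhs≡y = trans (ℤP.+-identityˡ (ℤ.+ 1 ℤ.* y)) (ℤP.*-identityˡ y)

slanted? : Decidable Slanted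
slanted? ℓ = ¬? (a ℓ ℤ.≟ ℤ.+ 0) ×-dec ¬? (b ℓ ℤ.≟ ℤ.+ 0)

axisParallel : ∀ {ℓ x₀ y₀} → ¬ Slanted ℓ → OnLine ℓ (x₀ , y₀) →
               (∀ {p} → OnLine ℓ p → OnLine (vertical x₀) p) ⊎ (∀ {p} → OnLine ℓ p → OnLine (horizontal y₀) p)
axisParallel {line a b c nondeg} {x₀} {y₀} not-slanted on₀ with a ℤ.≟ ℤ.+ 0 | b ℤ.≟ ℤ.+ 0
... | yes refl | yes refl = ⊥-elim (nondeg (refl , refl))
... | no  a≢0  | no  b≢0  = ⊥-elim (not-slanted (a≢0 , b≢0))
... | yes refl | no  b≢0  = inj₂ λ { {x , y} on → Equivalence.from (onHorizontal⇔ {x = x})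
        (ℤP.*-cancelˡ-≡ b y y₀ {{ℤ.≢-nonZero b≢0}}
          (trans (sym (ℤP.+-identityˡ (b ℤ.* y))) (trans on (trans (sym on₀) (ℤP.+-identityˡ (b ℤ.* y₀)))))) }
... | no  a≢0  | yes refl = inj₁ λ { {x , y} on → Equivalence.from (onVertical⇔ {y = y})
        (ℤP.*-cancelˡ-≡ a x x₀ {{ℤ.≢-nonZero a≢0}}
          (trans (sym (ℤP.+-identityʳ (a ℤ.* x))) (trans on (trans (sym on₀) (ℤP.+-identityʳ (a ℤ.* x₀)))))) }

length≤1⊎meetsGridTwice : ∀ {n ℓ} xs → Unique xs → All (InGrid n) xs → All (OnLine ℓ) xs →
                          length xs ≤ 1 ⊎ MeetsGridTwice n ℓ
length≤1⊎meetsGridTwice []          _               _             _             = inj₁ z≤n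
length≤1⊎meetsGridTwice (_ ∷ [])    _               _             _             = inj₁ ℕP.≤-refl
length≤1⊎meetsGridTwice (p ∷ q ∷ _) ((p≢q ∷ _) ∷ _) (gp ∷ gq ∷ _) (op ∷ oq ∷ _) = inj₂ (p , q , p≢q , gp , gq , op , oq)

m≤1∧m≤k*n⇒m≤k : ∀ {m} k n → m ≤ 1 → m ≤ k * n → m ≤ k
m≤1∧m≤k*n⇒m≤k zero    _ _   m≤0 = m≤0
m≤1∧m≤k*n⇒m≤k (suc k) _ m≤1 _   = ℕP.≤-trans m≤1 (s≤s z≤n)

count-line : ∀ {n ℓ S} (e : Fin n → Point) → Injective _≡_ _≡_ e → (∀ t → OnLine ℓ (e t)) →
             (∀ {p} → InGrid n p → OnLine ℓ p → ∃[ t ] e t ≡ p) → GridSet n S →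
             count ℓ S ≡ ∣ toSubset (λ t → e t ∈ₗ? S) ∣
count-line {ℓ = ℓ} {S} e e-injective e-on enumerates (inGrid , unique) = begin
  length (filter (onLine? ℓ) S)                     ≡⟨ length≡∣enumerated∣ _≟ᵖ_ e-injective
                                                         (Unique.filter⁺ (onLine? ℓ) unique)
                                                         (All.zipWith (uncurry enumerates)
                                                           (All.filter⁺ (onLine? ℓ) inGrid , all-filter (onLine? ℓ) S)) ⟩
  ∣ toSubset (λ t → e t ∈ₗ? filter (onLine? ℓ) S) ∣  ≡⟨ cong ∣_∣ (toSubset-cong
                                                         (λ t → e t ∈ₗ? filter (onLine? ℓ) S) (λ t → e t ∈ₗ? S)
                                                         (proj₁ ∘ ∈-filter⁻ (onLine? ℓ) {xs = S})
                                                         (λ {t} et∈S → ∈-filter⁺ (onLine? ℓ) et∈S (e-on t))) ⟩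
  ∣ toSubset (λ t → e t ∈ₗ? S) ∣                    ∎
  where open ≡-Reasoning

-- S as a bipartite graph: x-index i is adjacent to y-index j iff (i + 1, j + 1) ∈ S.
incidence : ∀ {n} → List Point → Fin n → Subset n
incidence S i = toSubset (λ j → point i j ∈ₗ? S)

module _ {n} {S : List Point} (grid : GridSet n S) where

  count-vertical : ∀ i → count (vertical (coord i)) S ≡ ∣ incidence S i ∣
  count-vertical i = count-line {ℓ = vertical (coord i)} (point i) (λ eq → proj₂ (point-injective eq))
    (λ j → Equivalence.from (onVertical⇔ {y = coord j}) refl) enumerates grid
    where
    enumerates : ∀ {p} → InGrid n p → OnLine (vertical (coord i)) p → ∃[ j ] point i j ≡ p
    enumerates g on with _ , j , refl ← inGrid⇒point g =
      j , cong (_, coord j) (sym (Equivalence.to (onVertical⇔ {y = coord j}) on))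

  count-horizontal : ∀ j → count (horizontal (coord j)) S ≡ ∣ column (incidence S) j ∣
  count-horizontal j = trans
    (count-line {ℓ = horizontal (coord j)} (λ i → point i j) (λ eq → proj₁ (point-injective eq))
      (λ i → Equivalence.from (onHorizontal⇔ {x = coord i}) refl) enumerates grid)
    (cong ∣_∣ (toSubset-cong (λ i → point i j ∈ₗ? S) (λ i → j ∈? incidence S i)
      (λ {i} → ∈toSubset⁺ (λ j → point i j ∈ₗ? S)) (λ {i} → ∈toSubset⁻ (λ j → point i j ∈ₗ? S))))
    where
    enumerates : ∀ {p} → InGrid n p → OnLine (horizontal (coord j)) p → ∃[ i ] point i j ≡ p
    enumerates g on with i , _ , refl ← inGrid⇒point g =
      i , cong (coord i ,_) (sym (Equivalence.to (onHorizontal⇔ {x = coord i}) on))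

  length≡∑∣incidence∣ : length S ≡ ∑[ i < n ] ∣ incidence S i ∣
  length≡∑∣incidence∣ = trans
    (length≡∑length-filter {m = n} {P = λ i → OnLine (vertical (coord i))} (λ i → onLine? (vertical (coord i))) S
      (All.map on-one-vertical (proj₁ grid)))
    (sum-cong-≗ {n} count-vertical)
    where
    on-one-vertical : ∀ {p} → InGrid n p → ∑[ i < n ] [ onLine? (vertical (coord i)) p ] ≡ 1
    on-one-vertical g with i₀ , j₀ , refl ← inGrid⇒point g = begin
      ∑[ i < n ] [ onLine? (vertical (coord i)) (point i₀ j₀) ]  ≡⟨ sum-cong-≗ (λ i →
        []-cong (onLine? (vertical (coord i)) (point i₀ j₀)) (i ∈? ⁅ i₀ ⁆)
          (λ on → subst (_∈ ⁅ i₀ ⁆) (coord-injective (Equivalence.to (onVertical⇔ {y = coord j₀}) on)) (x∈⁅x⁆ i₀))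
          (λ i∈ → Equivalence.from (onVertical⇔ {y = coord j₀}) (cong coord (sym (x∈⁅y⁆⇒x≡y i₀ i∈))))) ⟩
      ∑[ i < n ] [ i ∈? ⁅ i₀ ⁆ ]                                 ≡⟨ ∣p∣≡∑ ⁅ i₀ ⁆ ⟨
      ∣ ⁅ i₀ ⁆ ∣                                                 ≡⟨ ∣⁅x⁆∣≡1 i₀ ⟩
      1                                                          ∎
      where open ≡-Reasoning

  incidence-regular : ∀ {k} → (∀ ℓ → count ℓ S ≤ k) → length S ≡ k * n → Regular k (incidence S)
  incidence-regular {k} bounded |S|≡kn =
    ∑-tight ∣row∣≤k ∑∣row∣≡nk , ∑-tight ∣column∣≤k (trans (sym (∑∣row∣≡∑∣column∣ (incidence {n} S))) ∑∣row∣≡nk)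
    where
    ∣row∣≤k : ∀ i → ∣ incidence S i ∣ ≤ k
    ∣row∣≤k i = subst (_≤ k) (count-vertical i) (bounded (vertical (coord i)))
    ∣column∣≤k : ∀ j → ∣ column (incidence S) j ∣ ≤ k
    ∣column∣≤k j = subst (_≤ k) (count-horizontal j) (bounded (horizontal (coord j)))
    ∑∣row∣≡nk : ∑[ i < n ] ∣ incidence S i ∣ ≡ n * k
    ∑∣row∣≡nk = trans (sym length≡∑∣incidence∣) (trans |S|≡kn (ℕP.*-comm k n))

  regular⇒length : ∀ {k} → Regular k (incidence S) → length S ≡ k * n
  regular⇒length {k} (∣row∣≡ , _) =
    trans length≡∑∣incidence∣ (trans (sum-cong-≗ {n} ∣row∣≡) (trans (∑-const n k) (ℕP.*-comm n k)))

  regular⇒count-axis≤ : ∀ {k ℓ} → Regular k (incidence S) → ¬ Slanted ℓ → count ℓ S ≤ k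
  regular⇒count-axis≤ {k} {ℓ} (∣row∣≡ , ∣column∣≡) not-slanted with any? (onLine? ℓ) S
  ... | no  none = subst (λ xs → length xs ≤ k) (sym (filter-none (onLine? ℓ) (¬Any⇒All¬ S none))) z≤n
  ... | yes some with p , p∈S , on-p ← find some with i , j , refl ← inGrid⇒point (All.lookup (proj₁ grid) p∈S)
      with axisParallel {ℓ} {coord i} {coord j} not-slanted on-p
  ... | inj₁ ⊆vertical = begin
    count ℓ S                       ≤⟨ length-filter-mono (onLine? ℓ) (onLine? (vertical (coord i))) ⊆vertical S ⟩
    count (vertical (coord i)) S    ≡⟨ count-vertical i ⟩
    ∣ incidence S i ∣               ≡⟨ ∣row∣≡ i ⟩
    k                               ∎
    where open ℕP.≤-Reasoning
  ... | inj₂ ⊆horizontal = begin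
    count ℓ S                       ≤⟨ length-filter-mono (onLine? ℓ) (onLine? (horizontal (coord j))) ⊆horizontal S ⟩
    count (horizontal (coord j)) S  ≡⟨ count-horizontal j ⟩
    ∣ column (incidence S) j ∣      ≡⟨ ∣column∣≡ j ⟩
    k                               ∎
    where open ℕP.≤-Reasoning

  regular∧reserve⇒noInLine : ∀ {k h} → Regular k (incidence S) → HasReserve n k h S → ∀ ℓ → count ℓ S ≤ k
  regular∧reserve⇒noInLine {k} regular reserve ℓ with slanted? ℓ
  ... | no  not-slanted = regular⇒count-axis≤ {ℓ = ℓ} regular not-slanted
  ... | yes slanted with length≤1⊎meetsGridTwice {n} {ℓ} (filter (onLine? ℓ) S)
                           (Unique.filter⁺ (onLine? ℓ) (proj₂ grid)) (All.filter⁺ (onLine? ℓ) (proj₁ grid))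
                           (all-filter (onLine? ℓ) S)
  ...   | inj₂ twice   = ℕP.m+n≤o⇒m≤o (count ℓ S) (reserve ℓ slanted twice)
  ...   | inj₁ count≤1 = m≤1∧m≤k*n⇒m≤k k n count≤1
                           (subst (count ℓ S ≤_) (regular⇒length regular) (length-filter (onLine? ℓ) S))

InSubgraph : ∀ {n} → (Fin n → Subset n) → Point → Set
InSubgraph E p = ∃[ i ] ∃[ j ] point i j ≡ p × j ∈ E i

inSubgraph? : ∀ {n} (E : Fin n → Subset n) → Decidable (InSubgraph E)
inSubgraph? E p = Fin.any? λ i → Fin.any? λ j → (point i j ≟ᵖ p) ×-dec (j ∈? E i)

incidence-filter-inSubgraph : ∀ {n S} {E : Fin n → Subset n} → (∀ i → E i ⊆ incidence S i) →
                              ∀ i → incidence (filter (inSubgraph? E) S) i ≡ E i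
incidence-filter-inSubgraph {n} {S} {E} E⊆incidence i = ⊆-antisym ⊆E ⊇E
  where
  ⊆E : incidence (filter (inSubgraph? E) S) i ⊆ E i
  ⊆E {j} j∈
    with _ , (i′ , j′ , eq , j′∈Ei′) ← ∈-filter⁻ (inSubgraph? E) {xs = S}
                                        (∈toSubset⁻ (λ j → point i j ∈ₗ? filter (inSubgraph? E) S) j∈)
    with refl , refl ← point-injective eq
    = j′∈Ei′
  ⊇E : E i ⊆ incidence (filter (inSubgraph? E) S) i
  ⊇E {j} j∈Ei = ∈toSubset⁺ (λ j → point i j ∈ₗ? filter (inSubgraph? E) S)
    (∈-filter⁺ (inSubgraph? E) (∈toSubset⁻ (λ j → point i j ∈ₗ? S) (E⊆incidence i j∈Ei)) (i , j , refl , j∈Ei))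

regular-subset : ∀ {n k k′ S} → GridSet n S → Regular k (incidence S) → k′ ≤ k →
                 ∃[ S′ ] GridSet n S′ × Regular k′ (incidence S′) × (∀ ℓ → count ℓ S′ ≤ count ℓ S)
regular-subset {n} {k} {k′} {S} (inGrid , unique) regular k′≤k
  with E′ , E′⊆incidence , regular′ ←
       regular-subgraph (k ∸ k′) (subst (λ d → Regular d (incidence {n} S)) (sym (ℕP.m∸n+n≡m k′≤k)) regular)
  = filter (inSubgraph? E′) S
  , (All.filter⁺ (inSubgraph? E′) inGrid , Unique.filter⁺ (inSubgraph? E′) unique)
  , Regular-cong (sym ∘ incidence-filter-inSubgraph {S = S} E′⊆incidence) regular′
  , λ ℓ → length-filter-filter≤ (inSubgraph? E′) (onLine? ℓ) S

HasReserve-transfer : ∀ {n k h k′ h′ S S′} → (∀ ℓ → count ℓ S′ ≤ count ℓ S) → HasReserve n k h S →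
                      k + h′ ≡ h + k′ → HasReserve n k′ h′ S′
HasReserve-transfer {k = k} {h} {k′} {h′} {S} {S′} S′≤S reserve k+h′≡h+k′ ℓ slanted twice =
  ℕP.+-cancelˡ-≤ h (count ℓ S′ + h′) k′ (begin
    h + (count ℓ S′ + h′)  ≡⟨ ℕP.+-comm h _ ⟩
    count ℓ S′ + h′ + h    ≡⟨ ℕP.+-assoc (count ℓ S′) h′ h ⟩
    count ℓ S′ + (h′ + h)  ≡⟨ cong (count ℓ S′ +_) (ℕP.+-comm h′ h) ⟩
    count ℓ S′ + (h + h′)  ≡⟨ ℕP.+-assoc (count ℓ S′) h h′ ⟨
    count ℓ S′ + h + h′    ≤⟨ ℕP.+-monoˡ-≤ h′ (ℕP.+-monoˡ-≤ h (S′≤S ℓ)) ⟩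
    count ℓ S + h + h′     ≤⟨ ℕP.+-monoˡ-≤ h′ (reserve ℓ slanted twice) ⟩
    k + h′                 ≡⟨ k+h′≡h+k′ ⟩
    h + k′                 ∎)
  where open ℕP.≤-Reasoning

lemma3p10 : (n k h : ℕ) → h ≤ k → k ≤ n →
    (S : List Point) → NoInLine n k S → length S ≡ k * n → HasReserve n k h S →
    (k' h' : ℕ) → h' ≤ k' → k' ≤ k → k + h' ≡ h + k' →
    ∃[ S' ] (NoInLine n k' S' × length S' ≡ k' * n × HasReserve n k' h' S')
lemma3p10 n k h _ _ S (grid , bounded) |S|≡kn reserve k′ h′ _ k′≤k k+h′≡h+k′ =
  let S′ , grid′ , regular′ , S′≤S = regular-subset grid (incidence-regular {S = S} grid bounded |S|≡kn) k′≤k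
      reserve′ = HasReserve-transfer {k′ = k′} {h′} {S} {S′} S′≤S reserve k+h′≡h+k′
  in  S′ , (grid′ , regular∧reserve⇒noInLine {S = S′} grid′ regular′ reserve′)
         , regular⇒length {S = S′} grid′ regular′ , reserve′
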